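{- There is a constant $C$ such that every connected finite simple graph $G$ with $n\ge 3$ vertices which has dimension at most $3$ or admits a realizer of the form $\{\pi_1,\pi_2,\pi_3,\overline{\pi_3}\}$ has at most $\frac{1}{4}n^2+Cn$ edges.
   Context: For a finite simple graph $G=(V,E)$, a realizer is a nonempty family $\mathcal{R}$ of linear orders of $V$ such that for every edge $S\in E$ and every vertex $x\in V\setminus S$ there is some $\pi\in\mathcal{R}$ with $x>y$ in $\pi$ for every $y\in S$. The dimension of $G$ is the least size of a realizer. For a linear order $\pi$, $\overline{\pi}$ denotes its reverse. A graph with dimension at most 3 or with a realizer $\{\pi_1,\pi_2,\pi_3,\overline{\pi_3}\}$ is said to have dimension at most $\langle 3\to 4\rangle$. -}

module Defs where

open import Data.Nat using (ℕ; zero; suc; _<_; _≤_)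
open import Data.Fin using (Fin; toℕ; opposite)
open import Data.Fin.Permutation using (Permutation′; _⟨$⟩ʳ_)
open import Data.Bool using (Bool; true; false; _∧_)
open import Data.List using (List; []; _∷_; length; filterᵇ; cartesianProduct; allFin)
open import Data.List.Membership.Propositional using (_∈_)
open import Data.List.Relation.Unary.Any using (Any)
open import Data.Product using (_×_; _,_; ∃; ∃-syntax; proj₁; proj₂)
open import Data.Sum using (_⊎_)
open import Relation.Binary.PropositionalEquality using (_≡_; _≢_)
open import Relation.Nullary using (¬_)
open import Data.Nat using (_<ᵇ_)

record Graph (n : ℕ) : Set where
  field
    adj   : Fin n → Fin n → Bool
    sym   : ∀ i j → adj i j ≡ adj j i
    irrefl : ∀ i → adj i i ≡ false
open Graph public

edgeCount : ∀ {n} → Graph n → ℕ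
edgeCount {n} G =
  length (filterᵇ (λ p → (toℕ (proj₁ p) <ᵇ toℕ (proj₂ p)) ∧ adj G (proj₁ p) (proj₂ p))
                  (cartesianProduct (allFin n) (allFin n)))

data Reachable {n : ℕ} (G : Graph n) : Fin n → Fin n → Set where
  here : ∀ {u} → Reachable G u u
  step : ∀ {u v w} → adj G u v ≡ true → Reachable G v w → Reachable G u w

Connected : ∀ {n} → Graph n → Set
Connected G = ∀ u v → Reachable G u v

-- A linear order on Fin n, given by the position of each vertex
-- (a bijection Fin n → Fin n).
LinOrder : ℕ → Set
LinOrder n = Permutation′ n

_<[_]_ : ∀ {n} → Fin n → LinOrder n → Fin n → Set
x <[ π ] y = toℕ (π ⟨$⟩ʳ x) < toℕ (π ⟨$⟩ʳ y)

revPos : ∀ {n} → LinOrder n → Fin n → Fin n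
revPos π x = opposite (π ⟨$⟩ʳ x)

-- Orders are given as position maps Fin n → Fin n (here always injective).
IsRealizer : ∀ {n} → Graph n → List (Fin n → Fin n) → Set
IsRealizer {n} G R =
  (R ≢ []) ×
  (∀ a b x → adj G a b ≡ true → x ≢ a → x ≢ b →
     Any (λ pos → (toℕ (pos a) < toℕ (pos x)) × (toℕ (pos b) < toℕ (pos x))) R)

DimLe3 : ∀ {n} → Graph n → Set
DimLe3 {n} G = ∃[ R ] (length R ≤ 3 × IsRealizer G (Data.List.map (λ π → π ⟨$⟩ʳ_) R))
  where open import Data.List using (map)

DimLe3→4 : ∀ {n} → Graph n → Set
DimLe3→4 {n} G =
  DimLe3 G ⊎
  (∃[ π₁ ] ∃[ π₂ ] ∃[ π₃ ]
     IsRealizer G ((π₁ ⟨$⟩ʳ_) ∷ (π₂ ⟨$⟩ʳ_) ∷ (π₃ ⟨$⟩ʳ_) ∷ revPos π₃ ∷ []))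

{-# OPTIONS --safe #-}
-- Take three orders σ, τ, ρ of the realizer, ρ being the one whose reverse is also present, if
-- any (smaller realizers are padded by repetition).  If x lies strictly between the ends of an edge ab in ρ,
-- neither ρ nor its reverse puts x above a and b, so σ or τ does.  Hence in a triangle with
-- ρ-middle vertex v, either another vertex of the triangle lies below v in both σ and τ, or v lies
-- below both other vertices in σ or in τ.  A vertex has at most two neighbours below it in both
-- σ and τ (one on each side of it in ρ), and a vertex v of the second kind is determined by the
-- other two, so there are O(n²) triangles.  The Mantel count  Σ_{ab ∈ E} (d a + d b) ≤ e n + 3 t
-- together with Cauchy–Schwarz  Σ (d a)² ≥ 4 e² / n  then gives  4 e ≤ n² + O(n).
module Submission where

open import Defs
open import Data.Nat using (ℕ; zero; suc; _+_; _*_; _≤_; _<_; z≤n; s≤s; _≤?_; _<?_; _<ᵇ_)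
open import Data.Nat.Properties
open import Data.Nat.Tactic.RingSolver using (solve-∀)
import Data.Nat.ListAction as List
open import Data.Nat.ListAction.Properties using (sum-++)
open import Data.Bool using (Bool; true; false; _∧_)
import Data.Bool.Properties as Bool
open import Data.Fin using (Fin; zero; suc; toℕ; opposite)
import Data.Fin.Properties as Fin
open import Data.Fin.Permutation using (_⟨$⟩ʳ_; _⟨$⟩ˡ_; inverseˡ)
open import Data.List using (List; []; _∷_; _++_; map; length; filterᵇ; cartesianProduct; allFin; tabulate)
open import Data.List.Properties using (map-++; map-∘; map-cong; map-tabulate)
open import Data.List.Relation.Unary.All using (All; []; _∷_; lookupWith)
open import Data.List.Relation.Unary.Any using (here; there)
open import Data.Product using (_×_; _,_; proj₁; proj₂; uncurry; ∃-syntax)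
open import Data.Sum using (_⊎_; inj₁; inj₂; [_,_]′)
import Data.Sum as Sum
open import Data.Empty using (⊥-elim)
open import Function using (id; _∘_)
open import Relation.Nullary using (Dec; yes; no; does; ¬_; contradiction)
open import Relation.Nullary.Reflects using (ofʸ; ofⁿ)
open import Relation.Nullary.Decidable using (_×-dec_; _⊎-dec_; map′)
open import Relation.Binary.PropositionalEquality hiding (sym)
import Relation.Binary.PropositionalEquality as ≡
open import Relation.Binary.Definitions using (tri<; tri≈; tri>)
open import Algebra.Properties.CommutativeSemigroup *-commutativeSemigroup using (x∙yz≈y∙xz)
open import Algebra.Properties.Semiring.Sum +-*-semiring
  using (sum; sum-syntax; ∑-distrib-+; ∑-comm; *-distribˡ-sum; *-distribʳ-sum; sum-cong-≗)

variable
  m n : ℕ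
  A B : Set
  G : Graph n
  σ τ ρ π : LinOrder n
  a b c x x′ y z : Fin n

∑-mono-≤ : {f g : Fin n → ℕ} → (∀ i → f i ≤ g i) → ∑[ i < n ] f i ≤ ∑[ i < n ] g i
∑-mono-≤ {zero} f≤g = z≤n
∑-mono-≤ {suc n} f≤g = +-mono-≤ (f≤g zero) (∑-mono-≤ (f≤g ∘ suc))

∑-const : ∀ n c → ∑[ i < n ] c ≡ n * c
∑-const zero c = refl
∑-const (suc n) c = cong (c +_) (∑-const n c)

∑-bounded : ∀ {f : Fin n → ℕ} k → (∀ i → f i ≤ k) → ∑[ i < n ] f i ≤ n * k
∑-bounded {n} k f≤k = ≤-trans (∑-mono-≤ f≤k) (≤-reflexive (∑-const n k))

∑³ : (Fin n → Fin n → Fin n → ℕ) → ℕ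
∑³ {n} f = ∑[ a < n ] ∑[ b < n ] ∑[ c < n ] f a b c

∑³-mono-≤ : {f g : Fin n → Fin n → Fin n → ℕ} → (∀ a b c → f a b c ≤ g a b c) → ∑³ f ≤ ∑³ g
∑³-mono-≤ f≤g = ∑-mono-≤ λ a → ∑-mono-≤ λ b → ∑-mono-≤ (f≤g a b)

∑²-distrib-+ : (f g : Fin m → Fin n → ℕ) →
  ∑[ i < m ] ∑[ j < n ] (f i j + g i j) ≡ ∑[ i < m ] ∑[ j < n ] f i j + ∑[ i < m ] ∑[ j < n ] g i j
∑²-distrib-+ f g = trans (sum-cong-≗ λ i → ∑-distrib-+ (f i) (g i)) (∑-distrib-+ (sum ∘ f) (sum ∘ g))

∑³-distrib-+ : (f g : Fin n → Fin n → Fin n → ℕ) → ∑³ (λ a b c → f a b c + g a b c) ≡ ∑³ f + ∑³ g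
∑³-distrib-+ {n} f g = trans (sum-cong-≗ λ a → ∑²-distrib-+ (f a) (g a))
  (∑-distrib-+ (λ a → ∑[ b < n ] ∑[ c < n ] f a b c) (λ a → ∑[ b < n ] ∑[ c < n ] g a b c))

∑³-swap₁₂ : (f : Fin n → Fin n → Fin n → ℕ) → ∑³ f ≡ ∑³ (λ a b c → f b a c)
∑³-swap₁₂ f = ∑-comm (λ a b → sum (f a b))

∑³-swap₂₃ : (f : Fin n → Fin n → Fin n → ℕ) → ∑³ f ≡ ∑³ (λ a b c → f a c b)
∑³-swap₂₃ f = sum-cong-≗ (λ a → ∑-comm (f a))

∑³-bounded₃ : ∀ {f : Fin n → Fin n → Fin n → ℕ} k →
              (∀ a b → ∑[ c < n ] f a b c ≤ k) → ∑³ f ≤ n * (n * k)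
∑³-bounded₃ k h = ∑-bounded _ (λ a → ∑-bounded k (h a))

∑³-bounded₂ : ∀ {f : Fin n → Fin n → Fin n → ℕ} k →
              (∀ a c → ∑[ b < n ] f a b c ≤ k) → ∑³ f ≤ n * (n * k)
∑³-bounded₂ {f = f} k h = ≤-trans (≤-reflexive (∑³-swap₂₃ f)) (∑³-bounded₃ k h)

∑³-bounded₁ : ∀ {f : Fin n → Fin n → Fin n → ℕ} k →
              (∀ b c → ∑[ a < n ] f a b c ≤ k) → ∑³ f ≤ n * (n * k)
∑³-bounded₁ {f = f} k h = ≤-trans (≤-reflexive (∑³-swap₁₂ f)) (∑³-bounded₂ k h)

indicator : Bool → ℕ
indicator true = 1
indicator false = 0

𝟙 : {P : Set} → Dec P → ℕ
𝟙 P? = indicator (does P?)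

𝟙-yes : {P : Set} (P? : Dec P) → P → 1 ≤ 𝟙 P?
𝟙-yes (yes _) _ = ≤-refl
𝟙-yes (no ¬p) p = ⊥-elim (¬p p)

𝟙-no : {P : Set} (P? : Dec P) → ¬ P → 𝟙 P? ≡ 0
𝟙-no (yes p) ¬p = ⊥-elim (¬p p)
𝟙-no (no _) _ = refl

𝟙-≤-⊎ : {P Q R : Set} (P? : Dec P) (Q? : Dec Q) (R? : Dec R) → (P → Q ⊎ R) → 𝟙 P? ≤ 𝟙 Q? + 𝟙 R?
𝟙-≤-⊎ (no _) _ _ _ = z≤n
𝟙-≤-⊎ (yes p) Q? R? split with split p
... | inj₁ q = ≤-trans (𝟙-yes Q? q) (m≤m+n (𝟙 Q?) (𝟙 R?))
... | inj₂ r = ≤-trans (𝟙-yes R? r) (m≤n+m (𝟙 R?) (𝟙 Q?))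

∑-𝟙-unique : {P : Fin n → Set} (P? : ∀ i → Dec (P i)) → (∀ {i j} → P i → P j → i ≡ j) →
             ∑[ i < n ] 𝟙 (P? i) ≤ 1
∑-𝟙-unique {zero} P? unique = z≤n
∑-𝟙-unique {suc n} P? unique with P? zero
... | yes p = ≤-reflexive (cong suc (begin
  ∑[ i < n ] 𝟙 (P? (suc i)) ≡⟨ sum-cong-≗ (λ i → 𝟙-no (P? (suc i)) (λ q → Fin.0≢1+n (unique p q))) ⟩
  ∑[ i < n ] 0              ≡⟨ ∑-const n 0 ⟩
  n * 0                     ≡⟨ *-zeroʳ n ⟩
  0                         ∎))
  where open ≡-Reasoning
... | no _ = ∑-𝟙-unique (P? ∘ suc) (λ p q → Fin.suc-injective (unique p q))

2*m*n≤m²+n² : ∀ m n → 2 * (m * n) ≤ m * m + n * n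
2*m*n≤m²+n² m n = [ below , flipped ]′ (≤-total m n)
  where
  square-expand : ∀ m k → 2 * (m * (m + k)) + k * k ≡ m * m + (m + k) * (m + k)
  square-expand = solve-∀
  below : ∀ {m n} → m ≤ n → 2 * (m * n) ≤ m * m + n * n
  below {m} m≤n with k , refl ← m≤n⇒∃[o]m+o≡n m≤n =
    ≤-trans (m≤m+n _ (k * k)) (≤-reflexive (square-expand m k))
  flipped : n ≤ m → 2 * (m * n) ≤ m * m + n * n
  flipped n≤m = subst₂ _≤_ (cong (2 *_) (*-comm n m)) (+-comm (n * n) (m * m)) (below n≤m)

∑-cauchy-schwarz : (f : Fin n → ℕ) → (∑[ i < n ] f i) * (∑[ i < n ] f i) ≤ n * ∑[ i < n ] (f i * f i)
∑-cauchy-schwarz {n} f = *-cancelˡ-≤ 2 (begin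
  2 * (S * S)
    ≡⟨ cong (2 *_) S*S≡∑∑ ⟩
  2 * ∑[ i < n ] ∑[ j < n ] (f i * f j)
    ≡⟨ *-distribˡ-sum 2 (λ i → ∑[ j < n ] (f i * f j)) ⟩
  ∑[ i < n ] (2 * ∑[ j < n ] (f i * f j))
    ≡⟨ sum-cong-≗ (λ i → *-distribˡ-sum 2 (λ j → f i * f j)) ⟩
  ∑[ i < n ] ∑[ j < n ] (2 * (f i * f j))
    ≤⟨ ∑-mono-≤ (λ i → ∑-mono-≤ λ j → 2*m*n≤m²+n² (f i) (f j)) ⟩
  ∑[ i < n ] ∑[ j < n ] (f i * f i + f j * f j)
    ≡⟨ ∑²-distrib-+ (λ i _ → f i * f i) (λ _ j → f j * f j) ⟩
  ∑[ i < n ] ∑[ j < n ] (f i * f i) + ∑[ i < n ] Q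
    ≡⟨ cong₂ _+_ (sum-cong-≗ λ i → ∑-const n (f i * f i)) (∑-const n Q) ⟩
  ∑[ i < n ] (n * (f i * f i)) + n * Q
    ≡⟨ cong (_+ n * Q) (*-distribˡ-sum n (λ i → f i * f i)) ⟨
  n * Q + n * Q
    ≡⟨ cong (n * Q +_) (+-identityʳ (n * Q)) ⟨
  2 * (n * Q) ∎)
  where
  open ≤-Reasoning
  S Q : ℕ
  S = ∑[ i < n ] f i
  Q = ∑[ i < n ] (f i * f i)
  S*S≡∑∑ : S * S ≡ ∑[ i < n ] ∑[ j < n ] (f i * f j)
  S*S≡∑∑ = trans (*-distribʳ-sum S f) (sum-cong-≗ λ i → *-distribˡ-sum (f i) f)

2*D≤n²+2*c*n : ∀ n D c → 2 * (D * D) ≤ n * (D * n + c * (n * n)) → 2 * D ≤ n * n + 2 * c * n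
2*D≤n²+2*c*n n zero c _ = z≤n
2*D≤n²+2*c*n n D@(suc _) c h with 2 * D ≤? n * n + 2 * c * n
... | yes small = small
... | no large = contradiction (+-cancelˡ-≤ (D * (n * n) + c * n * (n * n)) D 0 (begin
  D * (n * n) + c * n * (n * n) + D   ≤⟨ +-monoˡ-≤ D (+-monoʳ-≤ (D * (n * n)) (*-monoʳ-≤ (c * n) n²≤2D)) ⟩
  D * (n * n) + c * n * (2 * D) + D   ≡⟨ expand₁ n D c ⟩
  suc (n * n + 2 * c * n) * D         ≤⟨ *-monoˡ-≤ D (≰⇒> large) ⟩
  2 * D * D                           ≡⟨ *-assoc 2 D D ⟩
  2 * (D * D)                         ≤⟨ h ⟩
  n * (D * n + c * (n * n))           ≡⟨ expand₂ n D c ⟩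
  D * (n * n) + c * n * (n * n) + 0   ∎)) λ ()
  where
  open ≤-Reasoning
  n²≤2D : n * n ≤ 2 * D
  n²≤2D = ≤-trans (m≤m+n (n * n) (2 * c * n)) (<⇒≤ (≰⇒> large))
  expand₁ : ∀ n D c → D * (n * n) + c * n * (2 * D) + D ≡ suc (n * n + 2 * c * n) * D
  expand₁ = solve-∀
  expand₂ : ∀ n D c → n * (D * n + c * (n * n)) ≡ D * (n * n) + c * n * (n * n) + 0
  expand₂ = solve-∀

Adj : Graph n → Fin n → Fin n → Set
Adj G a b = adj G a b ≡ true

edge : Graph n → Fin n → Fin n → ℕ
edge G a b = indicator (adj G a b)

degree : Graph n → Fin n → ℕ
degree {n} G a = ∑[ b < n ] edge G a b

codegree : Graph n → Fin n → Fin n → ℕ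
codegree {n} G a b = ∑[ c < n ] (edge G a c * edge G b c)

triangles : Graph n → ℕ
triangles G = ∑³ λ a b c → edge G a b * (edge G a c * edge G b c)

length-filterᵇ : (p : A → Bool) (xs : List A) → length (filterᵇ p xs) ≡ List.sum (map (indicator ∘ p) xs)
length-filterᵇ p [] = refl
length-filterᵇ p (x ∷ xs) with p x
... | true = cong suc (length-filterᵇ p xs)
... | false = length-filterᵇ p xs

sum-map-cartesianProduct : (f : A × B → ℕ) (xs : List A) (ys : List B) →
  List.sum (map f (cartesianProduct xs ys)) ≡ List.sum (map (λ x → List.sum (map (λ y → f (x , y)) ys)) xs)
sum-map-cartesianProduct f [] ys = refl
sum-map-cartesianProduct f (x ∷ xs) ys = begin
  List.sum (map f (map (x ,_) ys ++ cartesianProduct xs ys))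
    ≡⟨ cong List.sum (map-++ f (map (x ,_) ys) (cartesianProduct xs ys)) ⟩
  List.sum (map f (map (x ,_) ys) ++ map f (cartesianProduct xs ys))
    ≡⟨ sum-++ (map f (map (x ,_) ys)) (map f (cartesianProduct xs ys)) ⟩
  List.sum (map f (map (x ,_) ys)) + List.sum (map f (cartesianProduct xs ys))
    ≡⟨ cong₂ _+_ (cong List.sum (≡.sym (map-∘ ys))) (sum-map-cartesianProduct f xs ys) ⟩
  List.sum (map (λ y → f (x , y)) ys) + List.sum (map (λ x → List.sum (map (λ y → f (x , y)) ys)) xs) ∎
  where open ≡-Reasoning

sum-tabulate : (f : Fin n → ℕ) → List.sum (tabulate f) ≡ ∑[ i < n ] f i
sum-tabulate {zero} f = refl
sum-tabulate {suc n} f = cong (f zero +_) (sum-tabulate (f ∘ suc))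

sum-map-allFin : (f : Fin n → ℕ) → List.sum (map f (allFin n)) ≡ ∑[ i < n ] f i
sum-map-allFin f = trans (cong List.sum (map-tabulate id f)) (sum-tabulate f)

edgeCount≡∑∑ : (G : Graph n) →
  edgeCount G ≡ ∑[ i < n ] ∑[ j < n ] indicator ((toℕ i <ᵇ toℕ j) ∧ adj G i j)
edgeCount≡∑∑ {n} G = begin
  edgeCount G
    ≡⟨ length-filterᵇ upper (cartesianProduct (allFin n) (allFin n)) ⟩
  List.sum (map (indicator ∘ upper) (cartesianProduct (allFin n) (allFin n)))
    ≡⟨ sum-map-cartesianProduct (indicator ∘ upper) (allFin n) (allFin n) ⟩
  List.sum (map (λ i → List.sum (map (λ j → indicator (upper (i , j))) (allFin n))) (allFin n))
    ≡⟨ cong List.sum (map-cong (λ i → sum-map-allFin (λ j → indicator (upper (i , j)))) (allFin n)) ⟩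
  List.sum (map (λ i → ∑[ j < n ] indicator (upper (i , j))) (allFin n))
    ≡⟨ sum-map-allFin (λ i → ∑[ j < n ] indicator (upper (i , j))) ⟩
  ∑[ i < n ] ∑[ j < n ] indicator (upper (i , j)) ∎
  where
  open ≡-Reasoning
  upper : Fin n × Fin n → Bool
  upper (i , j) = (toℕ i <ᵇ toℕ j) ∧ adj G i j

handshake : (G : Graph n) → 2 * edgeCount G ≡ ∑[ i < n ] degree G i
handshake {n} G = begin
  2 * edgeCount G                                 ≡⟨ cong (λ e → e + (e + 0)) (edgeCount≡∑∑ G) ⟩
  E + (E + 0)                                     ≡⟨ cong (E +_) (trans (+-identityʳ E) (∑-comm h)) ⟩
  E + ∑[ i < n ] ∑[ j < n ] h j i                 ≡⟨ ∑²-distrib-+ h (λ i j → h j i) ⟨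
  ∑[ i < n ] ∑[ j < n ] (h i j + h j i)           ≡⟨ sum-cong-≗ (λ i → sum-cong-≗ (λ j → split i j)) ⟩
  ∑[ i < n ] degree G i                           ∎
  where
  open ≡-Reasoning
  h : Fin n → Fin n → ℕ
  h i j = indicator ((toℕ i <ᵇ toℕ j) ∧ adj G i j)
  E : ℕ
  E = ∑[ i < n ] ∑[ j < n ] h i j
  split : ∀ i j → h i j + h j i ≡ edge G i j
  split i j with toℕ i <ᵇ toℕ j | <ᵇ-reflects-< (toℕ i) (toℕ j)
               | toℕ j <ᵇ toℕ i | <ᵇ-reflects-< (toℕ j) (toℕ i)
  ... | true  | ofʸ i<j | true  | ofʸ j<i = contradiction i<j (<-asym j<i)
  ... | true  | _       | false | _       = +-identityʳ (edge G i j)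
  ... | false | _       | true  | _       = cong indicator (sym G j i)
  ... | false | ofⁿ i≮j | false | ofⁿ j≮i
    rewrite Fin.toℕ-injective (≤-antisym (≮⇒≥ j≮i) (≮⇒≥ i≮j)) = cong indicator (≡.sym (irrefl G j))

indicator-+-≤ : ∀ x y → indicator x + indicator y ≤ 1 + indicator x * indicator y
indicator-+-≤ true  true  = s≤s (s≤s z≤n)
indicator-+-≤ true  false = ≤-refl
indicator-+-≤ false true  = ≤-refl
indicator-+-≤ false false = z≤n

degree-+-≤ : (G : Graph n) (a b : Fin n) → degree G a + degree G b ≤ n + codegree G a b
degree-+-≤ {n} G a b = begin
  degree G a + degree G b                         ≡⟨ ∑-distrib-+ (edge G a) (edge G b) ⟨
  ∑[ c < n ] (edge G a c + edge G b c)            ≤⟨ ∑-mono-≤ (λ c → indicator-+-≤ (adj G a c) (adj G b c)) ⟩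
  ∑[ c < n ] (1 + edge G a c * edge G b c)        ≡⟨ ∑-distrib-+ (λ _ → 1) (λ c → edge G a c * edge G b c) ⟩
  ∑[ c < n ] 1 + codegree G a b                   ≡⟨ cong (_+ codegree G a b) (trans (∑-const n 1) (*-identityʳ n)) ⟩
  n + codegree G a b                              ∎
  where open ≤-Reasoning

2*∑degree²≡ : (G : Graph n) →
  2 * ∑[ a < n ] (degree G a * degree G a) ≡ ∑[ a < n ] ∑[ b < n ] (edge G a b * (degree G a + degree G b))
2*∑degree²≡ {n} G = begin
  2 * Q
    ≡⟨ cong (Q +_) (+-identityʳ Q) ⟩
  Q + Q
    ≡⟨ cong₂ _+_ Q≡∑∑ Q≡∑∑′ ⟩
  ∑[ a < n ] ∑[ b < n ] (e a b * d a) + ∑[ a < n ] ∑[ b < n ] (e a b * d b)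
    ≡⟨ ∑²-distrib-+ (λ a b → e a b * d a) (λ a b → e a b * d b) ⟨
  ∑[ a < n ] ∑[ b < n ] (e a b * d a + e a b * d b)
    ≡⟨ sum-cong-≗ (λ a → sum-cong-≗ λ b → *-distribˡ-+ (e a b) (d a) (d b)) ⟨
  ∑[ a < n ] ∑[ b < n ] (e a b * (d a + d b)) ∎
  where
  open ≡-Reasoning
  e = edge G
  d = degree G
  Q : ℕ
  Q = ∑[ a < n ] (d a * d a)
  Q≡∑∑ : Q ≡ ∑[ a < n ] ∑[ b < n ] (e a b * d a)
  Q≡∑∑ = sum-cong-≗ λ a → *-distribʳ-sum (d a) (e a)
  Q≡∑∑′ : Q ≡ ∑[ a < n ] ∑[ b < n ] (e a b * d b)
  Q≡∑∑′ = trans Q≡∑∑ (trans (∑-comm λ a b → e a b * d a)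
                             (sum-cong-≗ λ b → sum-cong-≗ λ a → cong (λ x → indicator x * d a) (sym G a b)))

∑edge*[n+codegree]≡ : (G : Graph n) →
  ∑[ a < n ] ∑[ b < n ] (edge G a b * (n + codegree G a b)) ≡ (∑[ a < n ] degree G a) * n + triangles G
∑edge*[n+codegree]≡ {n} G = begin
  ∑[ a < n ] ∑[ b < n ] (e a b * (n + codegree G a b))
    ≡⟨ sum-cong-≗ (λ a → sum-cong-≗ λ b → trans (*-distribˡ-+ (e a b) n (codegree G a b))
                                                 (cong (e a b * n +_) (*-distribˡ-sum (e a b) (λ c → e a c * e b c)))) ⟩
  ∑[ a < n ] ∑[ b < n ] (e a b * n + ∑[ c < n ] (e a b * (e a c * e b c)))
    ≡⟨ ∑²-distrib-+ (λ a b → e a b * n) (λ a b → ∑[ c < n ] (e a b * (e a c * e b c))) ⟩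
  ∑[ a < n ] ∑[ b < n ] (e a b * n) + triangles G
    ≡⟨ cong (_+ triangles G) (trans (*-distribʳ-sum n (degree G)) (sum-cong-≗ λ a → *-distribʳ-sum n (e a))) ⟨
  (∑[ a < n ] degree G a) * n + triangles G ∎
  where
  open ≡-Reasoning
  e = edge G

2*∑degree²≤ : (G : Graph n) →
  2 * ∑[ a < n ] (degree G a * degree G a) ≤ (∑[ a < n ] degree G a) * n + triangles G
2*∑degree²≤ {n} G = begin
  2 * ∑[ a < n ] (degree G a * degree G a)                        ≡⟨ 2*∑degree²≡ G ⟩
  ∑[ a < n ] ∑[ b < n ] (edge G a b * (degree G a + degree G b))  ≤⟨ ∑-mono-≤ (λ a → ∑-mono-≤ λ b →
                                                                       *-monoʳ-≤ (edge G a b) (degree-+-≤ G a b)) ⟩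
  ∑[ a < n ] ∑[ b < n ] (edge G a b * (n + codegree G a b))       ≡⟨ ∑edge*[n+codegree]≡ G ⟩
  (∑[ a < n ] degree G a) * n + triangles G                       ∎
  where open ≤-Reasoning

triangles≤⇒4*edgeCount≤ : (G : Graph n) (c : ℕ) → triangles G ≤ c * (n * n) → 4 * edgeCount G ≤ n * n + 2 * c * n
triangles≤⇒4*edgeCount≤ {n} G c few = begin
  4 * edgeCount G       ≡⟨ *-assoc 2 2 (edgeCount G) ⟩
  2 * (2 * edgeCount G) ≡⟨ cong (2 *_) (handshake G) ⟩
  2 * D                 ≤⟨ 2*D≤n²+2*c*n n D c (begin
    2 * (D * D)                  ≤⟨ *-monoʳ-≤ 2 (∑-cauchy-schwarz (degree G)) ⟩
    2 * (n * Q)                  ≡⟨ x∙yz≈y∙xz 2 n Q ⟩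
    n * (2 * Q)                  ≤⟨ *-monoʳ-≤ n (2*∑degree²≤ G) ⟩
    n * (D * n + triangles G)    ≤⟨ *-monoʳ-≤ n (+-monoʳ-≤ (D * n) few) ⟩
    n * (D * n + c * (n * n))    ∎) ⟩
  n * n + 2 * c * n     ∎
  where
  open ≤-Reasoning
  D Q : ℕ
  D = ∑[ a < n ] degree G a
  Q = ∑[ a < n ] (degree G a * degree G a)

edge-triangle-≤ : (G : Graph n) {a b c : Fin n} {k : ℕ} → (Adj G a b → Adj G a c → Adj G b c → 1 ≤ k) →
                  edge G a b * (edge G a c * edge G b c) ≤ k
edge-triangle-≤ G {a} {b} {c} triangle with adj G a b | adj G a c | adj G b c
... | true  | true  | true  = triangle refl refl refl
... | false | _     | _     = z≤n
... | true  | false | _     = z≤n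
... | true  | true  | false = z≤n

position-injective : (π : LinOrder n) → toℕ (π ⟨$⟩ʳ x) ≡ toℕ (π ⟨$⟩ʳ y) → x ≡ y
position-injective π eq = trans (≡.sym (inverseˡ π)) (trans (cong (π ⟨$⟩ˡ_) (Fin.toℕ-injective eq)) (inverseˡ π))

<[]-connex : (π : LinOrder n) → x ≢ y → x <[ π ] y ⊎ y <[ π ] x
<[]-connex {x = x} {y} π x≢y with <-cmp (toℕ (π ⟨$⟩ʳ x)) (toℕ (π ⟨$⟩ʳ y))
... | tri< x<y _ _ = inj₁ x<y
... | tri≈ _ x≡y _ = contradiction (position-injective π x≡y) x≢y
... | tri> _ _ y<x = inj₂ y<x

_<[_]?_ : (x : Fin n) (π : LinOrder n) (y : Fin n) → Dec (x <[ π ] y)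
x <[ π ]? y = toℕ (π ⟨$⟩ʳ x) <? toℕ (π ⟨$⟩ʳ y)

data Between (π : LinOrder n) (a x b : Fin n) : Set where
  ascending  : a <[ π ] x → x <[ π ] b → Between π a x b
  descending : b <[ π ] x → x <[ π ] a → Between π a x b

Between? : (π : LinOrder n) (a x b : Fin n) → Dec (Between π a x b)
Between? π a x b = map′ [ uncurry ascending , uncurry descending ]′ from
                        ((a <[ π ]? x ×-dec x <[ π ]? b) ⊎-dec (b <[ π ]? x ×-dec x <[ π ]? a))
  where
  from : Between π a x b → (a <[ π ] x × x <[ π ] b) ⊎ (b <[ π ] x × x <[ π ] a)
  from (ascending a<x x<b) = inj₁ (a<x , x<b)
  from (descending b<x x<a) = inj₂ (b<x , x<a)

Above : LinOrder n → Fin n → Fin n → Fin n → Set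
Above π x a b = a <[ π ] x × b <[ π ] x

between-≢ˡ : Between π a x b → x ≢ a
between-≢ˡ (ascending a<x _) refl = <-irrefl refl a<x
between-≢ˡ (descending _ x<a) refl = <-irrefl refl x<a

between-≢ʳ : Between π a x b → x ≢ b
between-≢ʳ (ascending _ x<b) refl = <-irrefl refl x<b
between-≢ʳ (descending b<x _) refl = <-irrefl refl b<x

between-not-above : Between π a x b → ¬ Above π x a b
between-not-above (ascending _ x<b) (_ , b<x) = <-asym x<b b<x
between-not-above (descending _ x<a) (a<x , _) = <-asym x<a a<x

between-not-below : Between π a x b → ¬ (x <[ π ] a × x <[ π ] b)
between-not-below (ascending a<x _) (x<a , _) = <-asym x<a a<x
between-not-below (descending b<x _) (_ , x<b) = <-asym x<b b<x

middle : (π : LinOrder n) → a ≢ b → b ≢ c → a ≢ c → Between π b a c ⊎ Between π a b c ⊎ Between π a c b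
middle π a≢b b≢c a≢c with <[]-connex π a≢b | <[]-connex π b≢c | <[]-connex π a≢c
... | inj₁ a<b | inj₁ b<c | _        = inj₂ (inj₁ (ascending a<b b<c))
... | inj₁ a<b | inj₂ c<b | inj₁ a<c = inj₂ (inj₂ (ascending a<c c<b))
... | inj₁ a<b | inj₂ c<b | inj₂ c<a = inj₁ (descending c<a a<b)
... | inj₂ b<a | inj₁ b<c | inj₁ a<c = inj₁ (ascending b<a a<c)
... | inj₂ b<a | inj₁ b<c | inj₂ c<a = inj₂ (inj₂ (descending b<c c<a))
... | inj₂ b<a | inj₂ c<b | _        = inj₂ (inj₁ (descending c<b b<a))

between-split : (π : LinOrder n) → Between π z x y → Between π z x′ y → x ≢ x′ →
                (Between π z x x′ × Between π x x′ y) ⊎ (Between π z x′ x × Between π x′ x y)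
between-split π btw btw′ x≢x′ with btw | btw′ | <[]-connex π x≢x′
... | ascending z<x _   | ascending _ x′<y   | inj₁ x<x′ = inj₁ (ascending z<x x<x′ , ascending x<x′ x′<y)
... | ascending _ x<y   | ascending z<x′ _   | inj₂ x′<x = inj₂ (ascending z<x′ x′<x , ascending x′<x x<y)
... | descending y<x _  | descending _ x′<z  | inj₁ x<x′ = inj₂ (descending x<x′ x′<z , descending y<x x<x′)
... | descending _ x<z  | descending y<x′ _  | inj₂ x′<x = inj₁ (descending x′<x x<z , descending y<x′ x′<x)
... | ascending z<x x<y | descending y<x′ x′<z | _ = contradiction (<-trans z<x x<y) (<-asym (<-trans y<x′ x′<z))
... | descending y<x x<z | ascending z<x′ x′<y | _ = contradiction (<-trans z<x′ x′<y) (<-asym (<-trans y<x x<z))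

Adj? : (G : Graph n) (a b : Fin n) → Dec (Adj G a b)
Adj? G a b = adj G a b Bool.≟ true

adj-sym : (G : Graph n) → Adj G a b → Adj G b a
adj-sym {a = a} {b = b} G ab = trans (sym G b a) ab

adj-irrefl : (G : Graph n) → Adj G a b → a ≢ b
adj-irrefl {a = a} G ab refl with trans (≡.sym ab) (irrefl G a)
... | ()

record Covered (G : Graph n) (σ τ ρ : LinOrder n) : Set where
  field
    cover : Adj G a b → Between ρ a x b → Above σ x a b ⊎ Above τ x a b
open Covered

covered-swap : Covered G σ τ ρ → Covered G τ σ ρ
covered-swap cov .cover ab btw = Sum.swap (cover cov ab btw)

covered-above : Covered G σ τ ρ → Adj G a b → Between ρ a x b → x <[ τ ] a ⊎ x <[ τ ] b → Above σ x a b
covered-above cov ab btw low with cover cov ab btw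
... | inj₁ above = above
... | inj₂ (a<x , b<x) = ⊥-elim ([ <-asym a<x , <-asym b<x ]′ low)

opposite-< : {i j : Fin n} → toℕ (opposite i) < toℕ (opposite j) → toℕ j < toℕ i
opposite-< {n} {i} {j} lt = ≰⇒> λ i≤j →
  <⇒≱ (subst₂ _<_ (Fin.opposite-prop i) (Fin.opposite-prop j) lt) (∸-monoʳ-≤ n (s≤s i≤j))

LiftsNothingBetween : LinOrder n → (Fin n → Fin n) → Set
LiftsNothingBetween ρ pos =
  ∀ {a x b} → Between ρ a x b → ¬ (toℕ (pos a) < toℕ (pos x) × toℕ (pos b) < toℕ (pos x))

revPos-liftsNothingBetween : (ρ : LinOrder n) → LiftsNothingBetween ρ (revPos ρ)
revPos-liftsNothingBetween ρ btw (a<x , b<x) = between-not-below btw (opposite-< a<x , opposite-< b<x)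

realizer⇒covered : (σ τ ρ : LinOrder n) {rest : List (Fin n → Fin n)} → All (LiftsNothingBetween ρ) rest →
                   IsRealizer G ((σ ⟨$⟩ʳ_) ∷ (τ ⟨$⟩ʳ_) ∷ rest) → Covered G σ τ ρ
realizer⇒covered σ τ ρ rest-lifts-nothing (_ , realizes) .cover {a} {b} {x} ab btw
  with realizes a b x ab (between-≢ˡ btw) (between-≢ʳ btw)
... | here above = inj₁ above
... | there (here above) = inj₂ above
... | there (there lifted) = ⊥-elim (lookupWith (λ lifts-nothing → lifts-nothing btw) rest-lifts-nothing lifted)

dim⟨3→4⟩⇒covered : (G : Graph n) → DimLe3→4 G → ∃[ σ ] ∃[ τ ] ∃[ ρ ] Covered G σ τ ρ
dim⟨3→4⟩⇒covered G (inj₂ (σ , τ , ρ , r)) =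
  σ , τ , ρ , realizer⇒covered {G = G} σ τ ρ (between-not-above {π = ρ} ∷ revPos-liftsNothingBetween ρ ∷ []) r
dim⟨3→4⟩⇒covered G (inj₁ ([] , _ , nonempty , _)) = contradiction refl nonempty
dim⟨3→4⟩⇒covered G (inj₁ (σ ∷ [] , _ , _ , realizes)) =
  σ , σ , σ , realizer⇒covered {G = G} σ σ σ [] ((λ ()) , λ a b x ab x≢a x≢b → there (realizes a b x ab x≢a x≢b))
dim⟨3→4⟩⇒covered G (inj₁ (σ ∷ τ ∷ [] , _ , r)) = σ , τ , τ , realizer⇒covered {G = G} σ τ τ [] r
dim⟨3→4⟩⇒covered G (inj₁ (σ ∷ τ ∷ ρ ∷ [] , _ , r)) =
  σ , τ , ρ , realizer⇒covered {G = G} σ τ ρ (between-not-above {π = ρ} ∷ []) r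
dim⟨3→4⟩⇒covered G (inj₁ (_ ∷ _ ∷ _ ∷ _ ∷ _ , s≤s (s≤s (s≤s ())) , _))

Dominated : Graph n → LinOrder n → LinOrder n → Fin n → Fin n → Set
Dominated G σ τ a b = Adj G a b × a <[ σ ] b × a <[ τ ] b

Dominated? : (G : Graph n) (σ τ : LinOrder n) (a b : Fin n) → Dec (Dominated G σ τ a b)
Dominated? G σ τ a b = Adj? G a b ×-dec a <[ σ ]? b ×-dec a <[ τ ]? b

Valley : Graph n → LinOrder n → LinOrder n → Fin n → Fin n → Fin n → Set
Valley G ρ π z x y = Adj G z x × Adj G x y × Between ρ z x y × x <[ π ] z × x <[ π ] y

Valley? : (G : Graph n) (ρ π : LinOrder n) (z x y : Fin n) → Dec (Valley G ρ π z x y)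
Valley? G ρ π z x y = Adj? G z x ×-dec Adj? G x y ×-dec Between? ρ z x y ×-dec x <[ π ]? z ×-dec x <[ π ]? y

valleys-not-interleaved : Covered G σ τ ρ → Valley G ρ τ z x y → Valley G ρ τ z x′ y →
                          Between ρ z x x′ → ¬ Between ρ x x′ y
valleys-not-interleaved cov (_ , xy , _ , x<z , _) (zx′ , _ , _ , _ , x′<y) zxx′ xx′y =
  <-asym (proj₁ (covered-above cov xy xx′y (inj₂ x′<y))) (proj₂ (covered-above cov zx′ zxx′ (inj₁ x<z)))

valley-unique : Covered G σ τ ρ → Valley G ρ τ z x y → Valley G ρ τ z x′ y → x ≡ x′
valley-unique {ρ = ρ} {x = x} {x′ = x′} cov v@(_ , _ , zxy , _) v′@(_ , _ , zx′y , _) with x Fin.≟ x′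
... | yes x≡x′ = x≡x′
... | no x≢x′ with between-split ρ zxy zx′y x≢x′
...   | inj₁ (zxx′ , xx′y) = contradiction xx′y (valleys-not-interleaved cov v v′ zxx′)
...   | inj₂ (zx′x , x′xy) = contradiction x′xy (valleys-not-interleaved cov v′ v zx′x)

dominated-not-between : Covered G σ τ ρ → Adj G a b → Dominated G σ τ x b → ¬ Between ρ a x b
dominated-not-between cov ab (_ , x<σb , x<τb) btw =
  <-asym x<σb (proj₂ (covered-above cov ab btw (inj₂ x<τb)))

dominated-same-side : Covered G σ τ ρ → Dominated G σ τ a b → Dominated G σ τ x b →
                      (a <[ ρ ] b × x <[ ρ ] b) ⊎ (b <[ ρ ] a × b <[ ρ ] x) → a ≡ x
dominated-same-side {ρ = ρ} {a = a} {x = x} cov dom@(ab , _) dom′@(xb , _) side with a Fin.≟ x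
... | yes a≡x = a≡x
... | no a≢x with side | <[]-connex ρ a≢x
...   | inj₁ (_ , x<b)   | inj₁ a<x = ⊥-elim (dominated-not-between cov ab dom′ (ascending a<x x<b))
...   | inj₁ (a<b , _)   | inj₂ x<a = ⊥-elim (dominated-not-between cov xb dom (ascending x<a a<b))
...   | inj₂ (b<a , _)   | inj₁ a<x = ⊥-elim (dominated-not-between cov xb dom (descending b<a a<x))
...   | inj₂ (_ , b<x)   | inj₂ x<a = ⊥-elim (dominated-not-between cov ab dom′ (descending b<x x<a))

dominated-count : Covered G σ τ ρ → (b : Fin n) → ∑[ a < n ] 𝟙 (Dominated? G σ τ a b) ≤ 2
dominated-count {n = n} {G = G} {σ = σ} {τ = τ} {ρ = ρ} cov b = begin
  ∑[ a < n ] 𝟙 (Dominated? G σ τ a b)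
    ≤⟨ ∑-mono-≤ (λ a → 𝟙-≤-⊎ (Dominated? G σ τ a b) (below? a) (above? a) side) ⟩
  ∑[ a < n ] (𝟙 (below? a) + 𝟙 (above? a))
    ≡⟨ ∑-distrib-+ (𝟙 ∘ below?) (𝟙 ∘ above?) ⟩
  ∑[ a < n ] 𝟙 (below? a) + ∑[ a < n ] 𝟙 (above? a)
    ≤⟨ +-mono-≤ (∑-𝟙-unique below? λ (d , a<b) (d′ , x<b) → dominated-same-side cov d d′ (inj₁ (a<b , x<b)))
                (∑-𝟙-unique above? λ (d , b<a) (d′ , b<x) → dominated-same-side cov d d′ (inj₂ (b<a , b<x))) ⟩
  2 ∎
  where
  open ≤-Reasoning
  below? above? : ∀ a → Dec (Dominated G σ τ a b × _)
  below? a = Dominated? G σ τ a b ×-dec a <[ ρ ]? b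
  above? a = Dominated? G σ τ a b ×-dec b <[ ρ ]? a
  side : Dominated G σ τ a b → (Dominated G σ τ a b × a <[ ρ ] b) ⊎ (Dominated G σ τ a b × b <[ ρ ] a)
  side d@(ab , _) = Sum.map (d ,_) (d ,_) (<[]-connex ρ (adj-irrefl G ab))

Charged : Graph n → (σ τ ρ : LinOrder n) → Fin n → Fin n → Fin n → Set
Charged G σ τ ρ a b c = (Dominated G σ τ a b ⊎ Dominated G σ τ c b) ⊎ (Valley G ρ τ a b c ⊎ Valley G ρ σ a b c)

Charged? : (G : Graph n) (σ τ ρ : LinOrder n) (a b c : Fin n) → Dec (Charged G σ τ ρ a b c)
Charged? G σ τ ρ a b c =
  (Dominated? G σ τ a b ⊎-dec Dominated? G σ τ c b) ⊎-dec (Valley? G ρ τ a b c ⊎-dec Valley? G ρ σ a b c)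

charged : Covered G σ τ ρ → Adj G a b → Adj G b c → Adj G a c → Between ρ a b c → Charged G σ τ ρ a b c
charged {G = G} {σ = σ} {τ = τ} cov ab bc ac btw with cover cov ac btw
... | inj₁ (a<σb , c<σb) with <[]-connex τ (adj-irrefl G ab) | <[]-connex τ (adj-irrefl G (adj-sym G bc))
...   | inj₁ a<τb | _         = inj₁ (inj₁ (ab , a<σb , a<τb))
...   | inj₂ _    | inj₁ c<τb = inj₁ (inj₂ (adj-sym G bc , c<σb , c<τb))
...   | inj₂ b<τa | inj₂ b<τc = inj₂ (inj₁ (ab , bc , btw , b<τa , b<τc))
charged {G = G} {σ = σ} {τ = τ} cov ab bc ac btw | inj₂ (a<τb , c<τb)
  with <[]-connex σ (adj-irrefl G ab) | <[]-connex σ (adj-irrefl G (adj-sym G bc))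
...   | inj₁ a<σb | _         = inj₁ (inj₁ (ab , a<σb , a<τb))
...   | inj₂ _    | inj₁ c<σb = inj₁ (inj₂ (adj-sym G bc , c<σb , c<τb))
...   | inj₂ b<σa | inj₂ b<σc = inj₂ (inj₂ (ab , bc , btw , b<σa , b<σc))

charge : Graph n → (σ τ ρ : LinOrder n) → Fin n → Fin n → Fin n → ℕ
charge G σ τ ρ a b c = 𝟙 (Charged? G σ τ ρ a b c)

charge-count : {G : Graph n} → Covered G σ τ ρ → ∑³ (charge G σ τ ρ) ≤ 6 * (n * n)
charge-count {n = n} {σ = σ} {τ = τ} {ρ = ρ} {G} cov = begin
  ∑³ (charge G σ τ ρ)
    ≤⟨ ∑³-mono-≤ split ⟩
  ∑³ (λ a b c → (d₁ a b c + d₂ a b c) + (v₁ a b c + v₂ a b c))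
    ≡⟨ trans (∑³-distrib-+ (λ a b c → d₁ a b c + d₂ a b c) (λ a b c → v₁ a b c + v₂ a b c))
             (cong₂ _+_ (∑³-distrib-+ d₁ d₂) (∑³-distrib-+ v₁ v₂)) ⟩
  (∑³ d₁ + ∑³ d₂) + (∑³ v₁ + ∑³ v₂)
    ≤⟨ +-mono-≤ (+-mono-≤ (∑³-bounded₁ 2 λ b _ → dominated-count cov b)
                          (∑³-bounded₃ 2 λ _ b → dominated-count cov b))
                (+-mono-≤ (∑³-bounded₂ 1 λ a c → ∑-𝟙-unique (λ b → V? τ a b c) (valley-unique cov))
                          (∑³-bounded₂ 1 λ a c → ∑-𝟙-unique (λ b → V? σ a b c) (valley-unique (covered-swap cov)))) ⟩
  (n * (n * 2) + n * (n * 2)) + (n * (n * 1) + n * (n * 1))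
    ≡⟨ six n ⟩
  6 * (n * n) ∎
  where
  open ≤-Reasoning
  D? = Dominated? G σ τ
  V? = Valley? G ρ
  d₁ d₂ v₁ v₂ : Fin n → Fin n → Fin n → ℕ
  d₁ a b c = 𝟙 (D? a b)
  d₂ a b c = 𝟙 (D? c b)
  v₁ a b c = 𝟙 (V? τ a b c)
  v₂ a b c = 𝟙 (V? σ a b c)
  split : ∀ a b c → charge G σ τ ρ a b c ≤ (d₁ a b c + d₂ a b c) + (v₁ a b c + v₂ a b c)
  split a b c = ≤-trans (𝟙-≤-⊎ (Charged? G σ τ ρ a b c) (D? a b ⊎-dec D? c b) (V? τ a b c ⊎-dec V? σ a b c) id)
                        (+-mono-≤ (𝟙-≤-⊎ (D? a b ⊎-dec D? c b) (D? a b) (D? c b) id)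
                                  (𝟙-≤-⊎ (V? τ a b c ⊎-dec V? σ a b c) (V? τ a b c) (V? σ a b c) id))
  six : ∀ n → (n * (n * 2) + n * (n * 2)) + (n * (n * 1) + n * (n * 1)) ≡ 6 * (n * n)
  six = solve-∀

triangle-charged : Covered G σ τ ρ → Adj G a b → Adj G a c → Adj G b c →
  1 ≤ charge G σ τ ρ b a c + charge G σ τ ρ a b c + charge G σ τ ρ a c b
triangle-charged {G = G} {σ = σ} {τ = τ} {ρ = ρ} {a = a} {b = b} {c = c} cov ab ac bc
  with middle ρ (adj-irrefl G ab) (adj-irrefl G bc) (adj-irrefl G ac)
... | inj₁ bac = ≤-trans (𝟙-yes (Charged? G σ τ ρ b a c) (charged cov (adj-sym G ab) ac bc bac))
                         (≤-trans (m≤m+n _ (charge G σ τ ρ a b c)) (m≤m+n _ (charge G σ τ ρ a c b)))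
... | inj₂ (inj₁ abc) = ≤-trans (𝟙-yes (Charged? G σ τ ρ a b c) (charged cov ab bc ac abc))
                                (≤-trans (m≤n+m _ (charge G σ τ ρ b a c)) (m≤m+n _ (charge G σ τ ρ a c b)))
... | inj₂ (inj₂ acb) = ≤-trans (𝟙-yes (Charged? G σ τ ρ a c b) (charged cov ac (adj-sym G bc) ab acb))
                                (m≤n+m _ (charge G σ τ ρ b a c + charge G σ τ ρ a b c))

covered⇒triangles≤ : {G : Graph n} → Covered G σ τ ρ → triangles G ≤ 18 * (n * n)
covered⇒triangles≤ {n = n} {σ = σ} {τ = τ} {ρ = ρ} {G} cov = begin
  triangles G
    ≤⟨ ∑³-mono-≤ (λ a b c → edge-triangle-≤ G {a} {b} {c} (triangle-charged cov)) ⟩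
  ∑³ (λ a b c → χ b a c + χ a b c + χ a c b)
    ≡⟨ trans (∑³-distrib-+ (λ a b c → χ b a c + χ a b c) (λ a b c → χ a c b))
             (cong (_+ ∑³ (λ a b c → χ a c b)) (∑³-distrib-+ (λ a b c → χ b a c) χ)) ⟩
  ∑³ (λ a b c → χ b a c) + ∑³ χ + ∑³ (λ a b c → χ a c b)
    ≡⟨ cong₂ _+_ (cong (_+ ∑³ χ) (∑³-swap₁₂ χ)) (∑³-swap₂₃ χ) ⟨
  ∑³ χ + ∑³ χ + ∑³ χ
    ≤⟨ +-mono-≤ (+-mono-≤ (charge-count cov) (charge-count cov)) (charge-count cov) ⟩
  6 * (n * n) + 6 * (n * n) + 6 * (n * n)
    ≡⟨ eighteen n ⟩
  18 * (n * n) ∎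
  where
  open ≤-Reasoning
  χ = charge G σ τ ρ
  eighteen : ∀ n → 6 * (n * n) + 6 * (n * n) + 6 * (n * n) ≡ 18 * (n * n)
  eighteen = solve-∀

theorem7 : ∃[ C ] (∀ (n : ℕ) → 3 ≤ n → (G : Graph n) → Connected G → DimLe3→4 G →
    4 * edgeCount G ≤ n * n + 4 * C * n)
theorem7 = 9 , λ n _ G _ dim →
  let σ , τ , ρ , cov = dim⟨3→4⟩⇒covered G dim
  in triangles≤⇒4*edgeCount≤ G 18 (covered⇒triangles≤ cov)
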